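{- Let $(A_1, A_2)$ be an $r \times n$ matrix pair over a field $\mathbb{K}$ with common column set $E = \{j_1,\dots,j_n\}$ (in column order). Let $A \in \mathbb{K}^{2r\times 2n}$ be the matrix whose columns $2i-1, 2i$ form the $2r\times 2$ block $\begin{pmatrix} A_1[\{j_i\}] & 0 \\ 0 & A_2[\{j_i\}]\end{pmatrix}$ for $i = 1,\dots,n$, and regard each $j\in E$ as the line of $A$ consisting of its two columns. If $(A_1, A_2)$ is Pfaffian with constant $c$, then $(A, E)$ is a Pfaffian parity with constant $(-1)^{r(r-1)/2}c$.
   Context: A base of $M\in\mathbb{K}^{r\times n}$ is a column subset $B$ with $|B|=r$ and $M[B]$ nonsingular (columns in original order). A matrix pair $(A_1,A_2)$ is Pfaffian with constant $c\neq 0$ if $\det A_1[B]\det A_2[B]=c$ for every common base $B$ of $A_1$ and $A_2$. For a matrix $A\in\mathbb{K}^{2r\times 2n}$ whose columns are partitioned into consecutive pairs (lines) with line set $L$, a parity base is a set of lines whose columns form a nonsingular submatrix $A[B]$ (original column order), and $(A,L)$ is a Pfaffian parity with constant $c\neq 0$ if $\det A[B]=c$ for all parity bases $B$. -}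

module Defs where

open import Level using (Level; _⊔_)
open import Data.Nat as ℕ using (ℕ; zero; suc; _∸_)
open import Data.Nat.DivMod using (_/_)
open import Data.Fin as Fin using (Fin; zero; suc; punchIn; splitAt; combine; remQuot; cast)
open import Data.Sum using (inj₁; inj₂)
open import Data.Product using (_×_; _,_; ∃)
open import Relation.Binary.PropositionalEquality using (_≡_; sym)
open import Relation.Nullary using (¬_)
open import Algebra.Bundles using (CommutativeRing)

record Field (c ℓ : Level) : Set (Level.suc (c ⊔ ℓ)) where
  field
    commutativeRing : CommutativeRing c ℓ
  open CommutativeRing commutativeRing public
  field
    1≉0 : ¬ (1# ≈ 0#)
    inverse : ∀ x → ¬ (x ≈ 0#) → ∃ λ y → (x * y) ≈ 1#

Matrix : ∀ {a} → Set a → ℕ → ℕ → Set a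
Matrix K m n = Fin m → Fin n → K

-- A column selection given as a strictly increasing map Fin k → Fin n;
-- these correspond exactly to k-element column subsets, listed in the
-- original column order.
StrictlyIncreasing : ∀ {k n} → (Fin k → Fin n) → Set
StrictlyIncreasing {k} B = ∀ (i j : Fin k) → i Fin.< j → B i Fin.< B j

cols : ∀ {a} {K : Set a} {m n k} → Matrix K m n → (Fin k → Fin n) → Matrix K m k
cols M B i j = M i (B j)

module FieldDefs {c ℓ} (F : Field c ℓ) where
  open Field F using (Carrier; _≈_; 0#; 1#; _+_; _*_; -_; _-_)

  altSum : ∀ {n} → (Fin n → Carrier) → Carrier
  altSum {zero}  f = 0#
  altSum {suc n} f = f zero - altSum (λ j → f (suc j))

  det : ∀ {n} → Matrix Carrier n n → Carrier
  det {zero}  M = 1#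
  det {suc n} M = altSum (λ j → M zero j * det (λ i k → M (suc i) (punchIn j k)))

  pow : Carrier → ℕ → Carrier
  pow x zero    = 1#
  pow x (suc k) = x * pow x k

  Nonsingular : ∀ {n} → Matrix Carrier n n → Set ℓ
  Nonsingular M = ¬ (det M ≈ 0#)

  IsBase : ∀ {r n} → Matrix Carrier r n → (Fin r → Fin n) → Set ℓ
  IsBase M B = StrictlyIncreasing B × Nonsingular (cols M B)

  PfaffianPair : ∀ {r n} → Matrix Carrier r n → Matrix Carrier r n → Carrier → Set ℓ
  PfaffianPair {r} {n} A₁ A₂ k =
    ¬ (k ≈ 0#) ×
    (∀ (B : Fin r → Fin n) → IsBase A₁ B → IsBase A₂ B →
       (det (cols A₁ B) * det (cols A₂ B)) ≈ k)

  -- Columns: Fin (n ℕ.* 2), column  combine i b  (= 2i + b, 0-based)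
  -- is the first (b = 0) or second (b = 1) column of line i.
  blockMatrix : ∀ {r n} → Matrix Carrier r n → Matrix Carrier r n →
                Matrix Carrier (r ℕ.+ r) (n ℕ.* 2)
  blockMatrix {r} {n} A₁ A₂ row col with remQuot {n} 2 col | splitAt r row
  ... | (j , zero)     | inj₁ i = A₁ i j
  ... | (j , zero)     | inj₂ i = 0#
  ... | (j , suc zero) | inj₁ i = 0#
  ... | (j , suc zero) | inj₂ i = A₂ i j

  lineColumns : ∀ {m n} → (Fin m → Fin n) → Fin (m ℕ.* 2) → Fin (n ℕ.* 2)
  lineColumns {m} S k with remQuot {m} 2 k
  ... | (q , b) = combine (S q) b

  -- A set S of lines (|S| = m, strictly increasing enumeration) is a parity
  -- base of A ∈ K^{2r × 2n} iff A[columns of S] is nonsingular; this requires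
  -- the submatrix to be square, i.e. 2m = 2r, witnessed by eq.
  IsParityBase : ∀ {r n m} → Matrix Carrier (r ℕ.+ r) (n ℕ.* 2) →
                 (Fin m → Fin n) → (m ℕ.* 2 ≡ r ℕ.+ r) → Set ℓ
  IsParityBase A S eq =
    StrictlyIncreasing S ×
    Nonsingular (λ i k → A i (lineColumns S (cast (sym eq) k)))

  PfaffianParity : ∀ {r n} → Matrix Carrier (r ℕ.+ r) (n ℕ.* 2) → Carrier → Set ℓ
  PfaffianParity {r} {n} A k =
    ¬ (k ≈ 0#) ×
    (∀ (m : ℕ) (S : Fin m → Fin n) (eq : m ℕ.* 2 ≡ r ℕ.+ r) → IsParityBase {r} A S eq →
       det (λ i j → A i (lineColumns S (cast (sym eq) j))) ≈ k)

  signFactor : ℕ → Carrier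
  signFactor r = pow (- 1#) ((r ℕ.* (r ∸ 1)) / 2)

-- A shuffle s places p columns of a square block T and q columns of a square
-- block U, each in their own order, into p + q positions.  The matrix with the
-- rows of T on top of those of U and columns arranged by s has determinant
-- (-1)^inv(s) · det T · det U, where inv(s) counts the pairs (U-column,
-- later T-column).  Expand along the first row, which belongs to T: only
-- T-columns contribute, and deleting T-column b at position k removes exactly
-- the k - b inversions it takes part in, matching the signs (-1)^k and (-1)^b of
-- the Laplace expansions of the whole matrix and of T.  For a set S of r
-- lines, A[S] is this matrix for T = A₁[S], U = A₂[S] and the interleaving
-- shuffle, which has r(r-1)/2 inversions.  So every parity base (it has r lines)
-- is a common base of A₁ and A₂, and det A[S] = (-1)^{r(r-1)/2} c.
module Submission where

open import Data.Nat as ℕ using (ℕ; zero; suc; _∸_)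
import Data.Nat.Properties as ℕₚ
open import Data.Nat.DivMod using (_/_; m*n/n≡m)
open import Data.Nat.Tactic.RingSolver using (solve-∀)
open import Data.Fin as Fin using (Fin; zero; suc; punchIn; splitAt; combine; remQuot; cast)
import Data.Fin.Properties as Finₚ
open import Data.Sum as Sum using (_⊎_; inj₁; inj₂)
open import Data.Product using (_×_; _,_; proj₁; proj₂; swap)
open import Function using (id; _∘_)
open import Relation.Binary.PropositionalEquality as ≡ using (_≡_)
open import Relation.Nullary using (¬_)
open import Defs

data Shuffle : ℕ → ℕ → ℕ → Set where
  []    : Shuffle 0 0 0
  left  : ∀ {p q n} → Shuffle p q n → Shuffle (suc p) q (suc n)
  right : ∀ {p q n} → Shuffle p q n → Shuffle p (suc q) (suc n)

source : ∀ {p q n} → Shuffle p q n → Fin n → Fin p ⊎ Fin q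
source (left s)  zero    = inj₁ zero
source (left s)  (suc k) = Sum.map suc id (source s k)
source (right s) zero    = inj₂ zero
source (right s) (suc k) = Sum.map id suc (source s k)

size : ∀ {p q n} → Shuffle p q n → n ≡ p ℕ.+ q
size []                    = ≡.refl
size (left s)              = ≡.cong suc (size s)
size {p} {suc q} (right s) = ≡.trans (≡.cong suc (size s)) (≡.sym (ℕₚ.+-suc p q))

inversions : ∀ {p q n} → Shuffle p q n → ℕ
inversions []            = 0
inversions (left s)      = inversions s
inversions {p} (right s) = p ℕ.+ inversions s

inversions-noLeft : ∀ {q n} (s : Shuffle 0 q n) → inversions s ≡ 0
inversions-noLeft []        = ≡.refl
inversions-noLeft (right s) = inversions-noLeft s

source-noLeft : ∀ {q n} (s : Shuffle 0 q n) k → source s k ≡ inj₂ (cast (size s) k)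
source-noLeft (right s) zero    = ≡.refl
source-noLeft (right s) (suc k) = ≡.cong (Sum.map id suc) (source-noLeft s k)

-- Removes column k, which should come from the left block; where it does
-- not, the result is junk.
deleteLeft : ∀ {p q n} → Shuffle (suc p) q (suc n) → Fin (suc n) → Shuffle p q n
deleteLeft (left s)                       zero    = s
deleteLeft {zero} (left s)                (suc k) = s
deleteLeft {suc p} {n = suc n} (left s)   (suc k) = left (deleteLeft s k)
deleteLeft {n = suc n} (right s)          zero    = right (deleteLeft s zero)
deleteLeft {n = suc n} (right s)          (suc k) = right (deleteLeft s k)

source-punchIn : ∀ {p q n} (s : Shuffle (suc p) q (suc n)) k {b} → source s k ≡ inj₁ b →
                 ∀ c → source s (punchIn k c) ≡ Sum.map (punchIn b) id (source (deleteLeft s k) c)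
source-punchIn (left s) zero ≡.refl c = ≡.refl
source-punchIn {zero} (left s) (suc k) e c with source s k
... | inj₂ _ with () ← e
source-punchIn {suc p} {n = suc n} (left s) (suc k) e c with source s k in eq
source-punchIn {suc p} {n = suc n} (left s) (suc k) ≡.refl zero    | inj₁ b = ≡.refl
source-punchIn {suc p} {n = suc n} (left s) (suc k) ≡.refl (suc c) | inj₁ b
  rewrite source-punchIn s k eq c with source (deleteLeft s k) c
... | inj₁ _ = ≡.refl
... | inj₂ _ = ≡.refl
source-punchIn {n = suc n} (right s) (suc k) e c with source s k in eq
source-punchIn {n = suc n} (right s) (suc k) ≡.refl zero    | inj₁ b = ≡.refl
source-punchIn {n = suc n} (right s) (suc k) ≡.refl (suc c) | inj₁ b
  rewrite source-punchIn s k eq c with source (deleteLeft s k) c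
... | inj₁ _ = ≡.refl
... | inj₂ _ = ≡.refl

quotRem-combine : ∀ {m n} (q : Fin m) (b : Fin n) → Fin.quotRem n (combine q b) ≡ (b , q)
quotRem-combine q b = ≡.cong swap (Finₚ.remQuot-combine q b)

interleave : ∀ r → Shuffle r r (r ℕ.* 2)
interleave zero    = []
interleave (suc r) = left (right (interleave r))

source-interleave-first : ∀ r (q : Fin r) → source (interleave r) (combine q zero) ≡ inj₁ q
source-interleave-first (suc r) zero    = ≡.refl
source-interleave-first (suc r) (suc q) rewrite source-interleave-first r q = ≡.refl

source-interleave-second : ∀ r (q : Fin r) → source (interleave r) (combine q (suc zero)) ≡ inj₂ q
source-interleave-second (suc r) zero    = ≡.refl
source-interleave-second (suc r) (suc q) rewrite source-interleave-second r q = ≡.refl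

inversions-interleave : ∀ r → inversions (interleave r) ≡ r ℕ.* (r ∸ 1) / 2
inversions-interleave r = begin
  inversions (interleave r)             ≡⟨ m*n/n≡m (inversions (interleave r)) 2 ⟨
  inversions (interleave r) ℕ.* 2 / 2   ≡⟨ ≡.cong (_/ 2) (twice r) ⟩
  r ℕ.* (r ∸ 1) / 2                     ∎
  where
  open ≡.≡-Reasoning
  arith : ∀ r → suc r ℕ.* 2 ℕ.+ suc r ℕ.* r ≡ suc (suc r) ℕ.* suc r
  arith = solve-∀
  twice : ∀ r → inversions (interleave r) ℕ.* 2 ≡ r ℕ.* (r ∸ 1)
  twice zero          = ≡.refl
  twice (suc zero)    = ≡.refl
  twice (suc (suc r)) = begin
    (suc r ℕ.+ inversions (interleave (suc r))) ℕ.* 2      ≡⟨ ℕₚ.*-distribʳ-+ 2 (suc r) _ ⟩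
    suc r ℕ.* 2 ℕ.+ inversions (interleave (suc r)) ℕ.* 2  ≡⟨ ≡.cong (suc r ℕ.* 2 ℕ.+_) (twice (suc r)) ⟩
    suc r ℕ.* 2 ℕ.+ suc r ℕ.* r                           ≡⟨ arith r ⟩
    suc (suc r) ℕ.* suc r                                 ∎

m*2≡r+r⇒m≡r : ∀ {m r} → m ℕ.* 2 ≡ r ℕ.+ r → m ≡ r
m*2≡r+r⇒m≡r {m} {r} eq = ℕₚ.*-cancelʳ-≡ m r 2 (≡.trans eq (r+r≡r*2 r))
  where
  r+r≡r*2 : ∀ r → r ℕ.+ r ≡ r ℕ.* 2
  r+r≡r*2 = solve-∀

module _ {a ℓ} (F : Field a ℓ) where
  open Field F hiding (zero)
  open FieldDefs F
  open import Algebra.Properties.Ring ring using (-1*x≈-x; -‿distribˡ-*; x[y-z]≈xy-xz; -‿involutive)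
  open import Algebra.Properties.CommutativeSemigroup *-commutativeSemigroup using (x∙yz≈y∙xz; interchange)
  open import Relation.Binary.Reasoning.Setoid setoid

  altSum-cong : ∀ {n} {f g : Fin n → Carrier} → (∀ k → f k ≈ g k) → altSum f ≈ altSum g
  altSum-cong {zero}  f≈g = refl
  altSum-cong {suc n} f≈g = +-cong (f≈g zero) (-‿cong (altSum-cong (f≈g ∘ suc)))

  altSum-zero : ∀ {n} {f : Fin n → Carrier} → (∀ k → f k ≈ 0#) → altSum f ≈ 0#
  altSum-zero {zero}  f≈0 = refl
  altSum-zero {suc n} f≈0 =
    trans (+-cong (f≈0 zero) (-‿cong (altSum-zero (f≈0 ∘ suc)))) (-‿inverseʳ 0#)

  *-distribˡ-altSum : ∀ {n} x (f : Fin n → Carrier) → x * altSum f ≈ altSum (λ k → x * f k)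
  *-distribˡ-altSum {zero}  x f = zeroʳ x
  *-distribˡ-altSum {suc n} x f = begin
    x * (f zero - altSum (f ∘ suc))       ≈⟨ x[y-z]≈xy-xz x _ _ ⟩
    x * f zero - x * altSum (f ∘ suc)     ≈⟨ +-cong refl (-‿cong (*-distribˡ-altSum x (f ∘ suc))) ⟩
    x * f zero - altSum (λ k → x * f (suc k)) ∎

  *-distribʳ-altSum : ∀ {n} x (f : Fin n → Carrier) → altSum f * x ≈ altSum (λ k → f k * x)
  *-distribʳ-altSum x f = begin
    altSum f * x                ≈⟨ *-comm _ x ⟩
    x * altSum f                ≈⟨ *-distribˡ-altSum x f ⟩
    altSum (λ k → x * f k)      ≈⟨ altSum-cong (λ k → *-comm x (f k)) ⟩
    altSum (λ k → f k * x)      ∎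

  det-cong : ∀ {n} {M N : Matrix Carrier n n} → (∀ i j → M i j ≈ N i j) → det M ≈ det N
  det-cong {zero}  M≈N = refl
  det-cong {suc n} M≈N =
    altSum-cong (λ j → *-cong (M≈N zero j) (det-cong (λ i k → M≈N (suc i) (punchIn j k))))

  det-cast : ∀ {m n} (e : m ≡ n) (M : Matrix Carrier n n) → det (λ i j → M (cast e i) (cast e j)) ≈ det M
  det-cast ≡.refl M =
    det-cong (λ i j → reflexive (≡.cong₂ M (Finₚ.cast-is-id ≡.refl i) (Finₚ.cast-is-id ≡.refl j)))

  pow-+ : ∀ x m n → pow x (m ℕ.+ n) ≈ pow x m * pow x n
  pow-+ x zero    n = sym (*-identityˡ _)
  pow-+ x (suc m) n = trans (*-cong refl (pow-+ x m n)) (sym (*-assoc _ _ _))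

  pow[-1]-square : ∀ k → pow (- 1#) k * pow (- 1#) k ≈ 1#
  pow[-1]-square zero    = *-identityˡ 1#
  pow[-1]-square (suc k) = begin
    (- 1# * pow (- 1#) k) * (- 1# * pow (- 1#) k)   ≈⟨ interchange _ _ _ _ ⟩
    (- 1# * - 1#) * (pow (- 1#) k * pow (- 1#) k)   ≈⟨ *-cong (trans (-1*x≈-x _) (-‿involutive 1#)) (pow[-1]-square k) ⟩
    1# * 1#                                         ≈⟨ *-identityˡ 1# ⟩
    1#                                              ∎

  pow[-1]*x≉0 : ∀ k {x} → ¬ (x ≈ 0#) → ¬ (pow (- 1#) k * x ≈ 0#)
  pow[-1]*x≉0 k {x} x≉0 σx≈0 = x≉0 (begin
    x                                          ≈⟨ sym (*-identityˡ x) ⟩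
    1# * x                                     ≈⟨ *-cong (sym (pow[-1]-square k)) refl ⟩
    pow (- 1#) k * pow (- 1#) k * x            ≈⟨ *-assoc _ _ _ ⟩
    pow (- 1#) k * (pow (- 1#) k * x)          ≈⟨ *-cong refl σx≈0 ⟩
    pow (- 1#) k * 0#                          ≈⟨ zeroʳ _ ⟩
    0#                                         ∎)

  factors-≉0 : ∀ {x y z} → ¬ (x * (y * z) ≈ 0#) → ¬ (y ≈ 0#) × ¬ (z ≈ 0#)
  factors-≉0 xyz≉0 =
    (λ y≈0 → xyz≉0 (trans (*-cong refl (trans (*-cong y≈0 refl) (zeroˡ _))) (zeroʳ _))) ,
    (λ z≈0 → xyz≉0 (trans (*-cong refl (trans (*-cong refl z≈0) (zeroʳ _))) (zeroʳ _)))

  x*y-z≈x*[y-w] : ∀ x y {w z} → z ≈ x * w → x * y - z ≈ x * (y - w)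
  x*y-z≈x*[y-w] x y z≈xw = trans (+-cong refl (-‿cong z≈xw)) (sym (x[y-z]≈xy-xz x y _))

  0-x*[y*z]≈-1*[x*y]*z : ∀ x y z → 0# - x * (y * z) ≈ - 1# * (x * y) * z
  0-x*[y*z]≈-1*[x*y]*z x y z = begin
    0# - x * (y * z)       ≈⟨ +-identityˡ _ ⟩
    - (x * (y * z))        ≈⟨ -‿cong (sym (*-assoc x y z)) ⟩
    - (x * y * z)          ≈⟨ -‿distribˡ-* (x * y) z ⟩
    - (x * y) * z          ≈⟨ *-cong (sym (-1*x≈-x (x * y))) refl ⟩
    - 1# * (x * y) * z     ∎

  sign : ∀ {p q n} → Shuffle p q n → Carrier
  sign s = pow (- 1#) (inversions s)

  blockDiag : ∀ {p q} → Matrix Carrier p p → Matrix Carrier q q →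
              Fin p ⊎ Fin q → Fin p ⊎ Fin q → Carrier
  blockDiag T U (inj₁ a) (inj₁ b) = T a b
  blockDiag T U (inj₁ a) (inj₂ b) = 0#
  blockDiag T U (inj₂ a) (inj₁ b) = 0#
  blockDiag T U (inj₂ a) (inj₂ b) = U a b

  shuffledBlockDiag : ∀ {p q n} → Matrix Carrier p p → Matrix Carrier q q →
                      Shuffle p q n → Matrix Carrier n n
  shuffledBlockDiag {p} T U s i k = blockDiag T U (splitAt p (cast (size s) i)) (source s k)

  minor : ∀ {n} → Matrix Carrier (suc n) (suc n) → Fin (suc n) → Matrix Carrier n n
  minor M j i k = M (suc i) (punchIn j k)

  blockDiag-minor : ∀ {p q} (T : Matrix Carrier (suc p) (suc p)) (U : Matrix Carrier q q) b x y →
    blockDiag T U (Sum.map suc id x) (Sum.map (punchIn b) id y) ≡ blockDiag (minor T b) U x y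
  blockDiag-minor T U b (inj₁ _) (inj₁ _) = ≡.refl
  blockDiag-minor T U b (inj₁ _) (inj₂ _) = ≡.refl
  blockDiag-minor T U b (inj₂ _) (inj₁ _) = ≡.refl
  blockDiag-minor T U b (inj₂ _) (inj₂ _) = ≡.refl

  minor-shuffledBlockDiag : ∀ {p q n} (s : Shuffle (suc p) q (suc n)) T U k {b} → source s k ≡ inj₁ b →
    ∀ i c → minor (shuffledBlockDiag T U s) k i c ≡ shuffledBlockDiag (minor T b) U (deleteLeft s k) i c
  minor-shuffledBlockDiag {p} s T U k e i c rewrite source-punchIn s k e c =
    blockDiag-minor T U _ (splitAt p (cast (size (deleteLeft s k)) i)) (source (deleteLeft s k) c)

  -- The first-row Laplace term of det (shuffledBlockDiag T U s) at column k, with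
  -- x = source s k, d = deleteLeft s k, and the minor already evaluated by induction.
  expansionTerm : ∀ {p q p′ q′ n′} → (Fin p → Carrier) → Fin p ⊎ Fin q → Shuffle p′ q′ n′ → Carrier
  expansionTerm g (inj₁ b) d = sign d * g b
  expansionTerm g (inj₂ _) d = 0#

  altSum-expansionTerm : ∀ {p q n} (s : Shuffle (suc p) q (suc n)) (g : Fin (suc p) → Carrier) →
    altSum (λ k → expansionTerm g (source s k) (deleteLeft s k)) ≈ sign s * altSum g
  altSum-expansionTerm {zero} (left s) g = x*y-z≈x*[y-w] (sign s) (g zero) (begin
    altSum (λ k → expansionTerm g (Sum.map suc id (source s k)) s)
      ≈⟨ altSum-zero (λ k → reflexive (≡.cong (λ x → expansionTerm g (Sum.map suc id x) s) (source-noLeft s k))) ⟩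
    0#                   ≈⟨ sym (zeroʳ _) ⟩
    sign s * 0#          ∎)
  altSum-expansionTerm {suc p} {q} {suc n} (left s) g = x*y-z≈x*[y-w] (sign s) (g zero) (begin
    altSum (λ k → expansionTerm g (Sum.map suc id (source s k)) (left (deleteLeft s k)))
      ≈⟨ altSum-cong (λ k → reflexive (shift (source s k) (deleteLeft s k))) ⟩
    altSum (λ k → expansionTerm (g ∘ suc) (source s k) (deleteLeft s k))
      ≈⟨ altSum-expansionTerm s (g ∘ suc) ⟩
    sign s * altSum (g ∘ suc) ∎)
    where
    shift : ∀ x (d : Shuffle p q n) → expansionTerm g (Sum.map suc id x) (left d) ≡ expansionTerm (g ∘ suc) x d
    shift (inj₁ _) d = ≡.refl
    shift (inj₂ _) d = ≡.refl
  altSum-expansionTerm {p} {suc q} {suc n} (right s) g = begin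
    0# - altSum (λ k → expansionTerm g (Sum.map id suc (source s k)) (right (deleteLeft s k)))
      ≈⟨ +-cong refl (-‿cong (altSum-cong (λ k → shift (source s k) (deleteLeft s k)))) ⟩
    0# - altSum (λ k → pow (- 1#) p * E k)
      ≈⟨ +-cong refl (-‿cong (sym (*-distribˡ-altSum (pow (- 1#) p) E))) ⟩
    0# - pow (- 1#) p * altSum E
      ≈⟨ +-cong refl (-‿cong (*-cong refl (altSum-expansionTerm s g))) ⟩
    0# - pow (- 1#) p * (sign s * altSum g)
      ≈⟨ 0-x*[y*z]≈-1*[x*y]*z _ _ _ ⟩
    - 1# * (pow (- 1#) p * sign s) * altSum g
      ≈⟨ *-cong (*-cong refl (sym (pow-+ _ p (inversions s)))) refl ⟩
    sign (right s) * altSum g ∎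
    where
    E : Fin (suc n) → Carrier
    E k = expansionTerm g (source s k) (deleteLeft s k)
    shift : ∀ x (d : Shuffle p q n) →
            expansionTerm g (Sum.map id suc x) (right d) ≈ pow (- 1#) p * expansionTerm g x d
    shift (inj₁ b) d = trans (*-cong (pow-+ _ p (inversions d)) refl) (*-assoc _ _ _)
    shift (inj₂ _) d = sym (zeroʳ _)

  det-shuffledBlockDiag : ∀ p {q n} (s : Shuffle p q n) T U →
    det (shuffledBlockDiag T U s) ≈ sign s * (det T * det U)
  det-shuffledBlockDiag zero s T U = begin
    det (shuffledBlockDiag T U s)
      ≈⟨ det-cong (λ i k → reflexive (≡.cong (blockDiag T U (inj₂ (cast (size s) i))) (source-noLeft s k))) ⟩
    det (λ i k → U (cast (size s) i) (cast (size s) k)) ≈⟨ det-cast (size s) U ⟩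
    det U                                               ≈⟨ sym (*-identityˡ _) ⟩
    1# * det U                                          ≈⟨ sym (*-identityˡ _) ⟩
    1# * (1# * det U)                                   ≡⟨ ≡.cong (λ m → pow (- 1#) m * _) (≡.sym (inversions-noLeft s)) ⟩
    sign s * (det T * det U)                            ∎
  det-shuffledBlockDiag (suc p) {n = suc n} s T U = begin
    altSum (λ k → M zero k * det (minor M k))
      ≈⟨ altSum-cong term ⟩
    altSum (λ k → expansionTerm g (source s k) (deleteLeft s k))
      ≈⟨ altSum-expansionTerm s g ⟩
    sign s * altSum g
      ≈⟨ *-cong refl (sym (*-distribʳ-altSum (det U) (λ b → T zero b * det (minor T b)))) ⟩
    sign s * (det T * det U) ∎
    where
    M = shuffledBlockDiag T U s
    g : Fin (suc p) → Carrier
    g b = T zero b * det (minor T b) * det U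
    term : ∀ k → M zero k * det (minor M k) ≈ expansionTerm g (source s k) (deleteLeft s k)
    term k with source s k in e
    ... | inj₂ _ = zeroˡ _
    ... | inj₁ b = begin
      T zero b * det (minor M k)
        ≈⟨ *-cong refl (det-cong (λ i c → reflexive (minor-shuffledBlockDiag s T U k e i c))) ⟩
      T zero b * det (shuffledBlockDiag (minor T b) U (deleteLeft s k))
        ≈⟨ *-cong refl (det-shuffledBlockDiag p (deleteLeft s k) (minor T b) U) ⟩
      T zero b * (sign (deleteLeft s k) * (det (minor T b) * det U))
        ≈⟨ x∙yz≈y∙xz _ _ _ ⟩
      sign (deleteLeft s k) * (T zero b * (det (minor T b) * det U))
        ≈⟨ *-cong refl (sym (*-assoc _ _ _)) ⟩
      sign (deleteLeft s k) * g b ∎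

  blockMatrix-lineColumns : ∀ {r n} (A₁ A₂ : Matrix Carrier r n) (S : Fin r → Fin n) i k →
    blockMatrix A₁ A₂ i (lineColumns S k)
      ≡ blockDiag (cols A₁ S) (cols A₂ S) (splitAt r i) (source (interleave r) k)
  blockMatrix-lineColumns {r} {n} A₁ A₂ S i k =
    ≡.subst (λ k → blockMatrix A₁ A₂ i (lineColumns S k)
                     ≡ blockDiag (cols A₁ S) (cols A₂ S) (splitAt r i) (source (interleave r) k))
            (Finₚ.combine-remQuot {r} 2 k)
            (atCombine (proj₁ (remQuot {r} 2 k)) (proj₂ (remQuot {r} 2 k)))
    where
    atCombine : ∀ (q : Fin r) (b : Fin 2) → blockMatrix A₁ A₂ i (lineColumns S (combine q b))
                  ≡ blockDiag (cols A₁ S) (cols A₂ S) (splitAt r i) (source (interleave r) (combine q b))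
    atCombine q b rewrite quotRem-combine q b | quotRem-combine (S q) b with b | splitAt r i
    ... | zero     | inj₁ _ rewrite source-interleave-first r q  = ≡.refl
    ... | zero     | inj₂ _ rewrite source-interleave-first r q  = ≡.refl
    ... | suc zero | inj₁ _ rewrite source-interleave-second r q = ≡.refl
    ... | suc zero | inj₂ _ rewrite source-interleave-second r q = ≡.refl

  det-blockMatrix-lineColumns : ∀ {r n} (A₁ A₂ : Matrix Carrier r n) (S : Fin r → Fin n) (eq : r ℕ.* 2 ≡ r ℕ.+ r) →
    det (λ i j → blockMatrix A₁ A₂ i (lineColumns S (cast (≡.sym eq) j)))
      ≈ sign (interleave r) * (det (cols A₁ S) * det (cols A₂ S))
  det-blockMatrix-lineColumns {r} A₁ A₂ S eq = begin
    det (λ i j → blockMatrix A₁ A₂ i (lineColumns S (cast (≡.sym eq) j)))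
      ≈⟨ det-cong (λ i j → reflexive (≡.trans (blockMatrix-lineColumns A₁ A₂ S i _) (rows i _))) ⟩
    det (λ i j → shuffledBlockDiag (cols A₁ S) (cols A₂ S) (interleave r) (cast (≡.sym eq) i) (cast (≡.sym eq) j))
      ≈⟨ det-cast (≡.sym eq) _ ⟩
    det (shuffledBlockDiag (cols A₁ S) (cols A₂ S) (interleave r))
      ≈⟨ det-shuffledBlockDiag r (interleave r) _ _ ⟩
    sign (interleave r) * (det (cols A₁ S) * det (cols A₂ S)) ∎
    where
    rows : ∀ i y → blockDiag (cols A₁ S) (cols A₂ S) (splitAt r i) y
                 ≡ blockDiag (cols A₁ S) (cols A₂ S) (splitAt r (cast (size (interleave r)) (cast (≡.sym eq) i))) y
    rows i y = ≡.cong (λ i → blockDiag (cols A₁ S) (cols A₂ S) (splitAt r i) y)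
                 (≡.sym (Finₚ.cast-involutive (size (interleave r)) (≡.sym eq) i))

  signFactor≡sign-interleave : ∀ r → signFactor r ≡ sign (interleave r)
  signFactor≡sign-interleave r = ≡.cong (pow (- 1#)) (≡.sym (inversions-interleave r))

open Field using (Carrier; _*_)
open FieldDefs using (PfaffianPair; PfaffianParity; blockMatrix; signFactor)

proposition2p11 : ∀ {a ℓ} (F : Field a ℓ) {r n : ℕ}
    (A₁ A₂ : Matrix (Carrier F) r n) (c : Carrier F) →
    PfaffianPair F A₁ A₂ c →
    PfaffianParity F {r} {n} (blockMatrix F {r} {n} A₁ A₂) (_*_ F (signFactor F r) c)
proposition2p11 F {r} {n} A₁ A₂ c (c≉0 , pfaffian) = pow[-1]*x≉0 F ((r ℕ.* (r ∸ 1)) / 2) c≉0 , parityBase⇒det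
  where
  open Field F using (_≈_; trans; *-cong; reflexive)
  open FieldDefs F using (det; lineColumns; IsParityBase)
  parityBase⇒det : ∀ m (S : Fin m → Fin n) (eq : m ℕ.* 2 ≡ r ℕ.+ r) → IsParityBase {r} (blockMatrix F A₁ A₂) S eq →
    det (λ i j → blockMatrix F A₁ A₂ i (lineColumns S (cast (≡.sym eq) j))) ≈ _*_ F (signFactor F r) c
  parityBase⇒det m S eq (increasing , nonsingular) with ≡.refl ← m*2≡r+r⇒m≡r {m} {r} eq =
    let detA = det-blockMatrix-lineColumns F {r} A₁ A₂ S eq
        nonsingular₁ , nonsingular₂ = factors-≉0 F (nonsingular ∘ trans detA)
    in trans detA (*-cong (reflexive (≡.sym (signFactor≡sign-interleave F r)))
                          (pfaffian S (increasing , nonsingular₁) (increasing , nonsingular₂)))
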